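{- For every integer $n\geq 3$, the local antimagic total chromatic number of the firecracker graph $F_{n,1}$ is $\chi_{lat}(F_{n,1})=2$.
   Context: All graphs are finite, simple and connected. For a graph $G$ with $n$ vertices and $m$ edges, a bijection $g:V(G)\cup E(G)\to\{1,2,\dots,n+m\}$ is a local antimagic total labeling if $\omega_t(u)\neq\omega_t(v)$ for every edge $uv$, where $\omega_t(u)=g(u)+\sum_{e\in E(u)}g(e)$ and $E(u)$ is the set of edges incident with $u$. The local antimagic total chromatic number $\chi_{lat}(G)$ is the minimum number of distinct values of $\omega_t$ over all local antimagic total labelings of $G$. The firecracker graph $F_{n,k}$ has vertex set $\{u_i:1\le i\le n\}\cup\{v_{i,j}:1\le i\le n,1\le j\le k\}$ and edge set $\{v_{i,1}v_{i+1,1}:1\le i\le n-1\}\cup\{u_iv_{i,j}:1\le i\le n,1\le j\le k\}$; thus $F_{n,1}$ is a path $v_{1,1}\cdots v_{n,1}$ with one pendant vertex $u_i$ attached to each $v_{i,1}$. -}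

module Defs where

open import Data.Nat using (ℕ; zero; suc; _+_; _≤_)
open import Data.Nat.Properties using () renaming (_≟_ to _≟ℕ_)
open import Data.Fin using (Fin; toℕ; inject₁) renaming (suc to fsuc)
open import Data.Fin.Properties using () renaming (_≟_ to _≟F_)
open import Data.List using (List; map; length; allFin; deduplicate)
open import Data.Nat.ListAction using (sum)
open import Data.Product using (_×_; _,_; proj₁; proj₂; Σ)
open import Data.Sum using (_⊎_; inj₁; inj₂)
open import Relation.Nullary using (¬_; yes; no)
open import Relation.Nullary.Decidable using (⌊_⌋)
open import Data.Bool using (if_then_else_; _∨_)
open import Function.Bundles using (Bijection; _⤖_)
open import Relation.Binary.PropositionalEquality using (_≡_; _≢_)

record Graph : Set where
  field
    nV   : ℕ
    nE   : ℕ
    ends : Fin nE → Fin nV × Fin nV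
open Graph public

-- Total labeling: a bijection V(G) ∪ E(G) → {1,…,n+m}
-- (encoded as a bijection onto Fin (nV + nE); the label of x is 1 + toℕ (g x)).
TotalLabeling : Graph → Set
TotalLabeling G = (Fin (nV G) ⊎ Fin (nE G)) ⤖ Fin (nV G + nE G)

label : (G : Graph) → TotalLabeling G → Fin (nV G) ⊎ Fin (nE G) → ℕ
label G g x = suc (toℕ (Bijection.to g x))

incident : (G : Graph) → Fin (nV G) → Fin (nE G) → Data.Bool.Bool
incident G u e = ⌊ u ≟F proj₁ (ends G e) ⌋ ∨ ⌊ u ≟F proj₂ (ends G e) ⌋

ωt : (G : Graph) → TotalLabeling G → Fin (nV G) → ℕ
ωt G g u = label G g (inj₁ u)
         + sum (map (λ e → if incident G u e then label G g (inj₂ e) else 0) (allFin (nE G)))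

IsLocalAntimagicTotal : (G : Graph) → TotalLabeling G → Set
IsLocalAntimagicTotal G g =
  (e : Fin (nE G)) → ωt G g (proj₁ (ends G e)) ≢ ωt G g (proj₂ (ends G e))

numColours : (G : Graph) → TotalLabeling G → ℕ
numColours G g = length (deduplicate _≟ℕ_ (map (ωt G g) (allFin (nV G))))

IsChiLat : Graph → ℕ → Set
IsChiLat G k =
  (Σ (TotalLabeling G) λ g → IsLocalAntimagicTotal G g × numColours G g ≡ k)
  × ((g : TotalLabeling G) → IsLocalAntimagicTotal G g → k ≤ numColours G g)

-- For n = suc k: vertices Fin (suc k + suc k), where
-- inj₁-part i (i.e. Fin.join … (inj₁ i)) is v_{i,1} and the inj₂-part i is u_i;
-- edges Fin (k + suc k): the first k are path edges v_{i,1} v_{i+1,1},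
-- the last suc k are pendant edges u_i v_{i,1}.
firecracker1 : ℕ → Graph
firecracker1 zero = record { nV = 0 ; nE = 0 ; ends = λ () }
firecracker1 (suc k) = record { nV = suc k + suc k ; nE = k + suc k ; ends = e }
  where
  v u : Fin (suc k) → Fin (suc k + suc k)
  v i = Data.Fin.join (suc k) (suc k) (inj₁ i)
  u i = Data.Fin.join (suc k) (suc k) (inj₂ i)
  e : Fin (k + suc k) → Fin (suc k + suc k) × Fin (suc k + suc k)
  e x with Data.Fin.splitAt k x
  ... | inj₁ i = v (inject₁ i) , v (fsuc i)
  ... | inj₂ i = u i , v i

-- The firecracker F_{n,1} is a tree, so in a labelling with two colours the two colour classes
-- are its bipartition classes: the path vertices at even positions together with the pendant
-- vertices at odd positions, and the rest. Labellings achieving this are given explicitly, one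
-- for odd and one for even n. Apart from a few elements at the ends of the path, every label is an
-- affine function of the position of its element along the path, counted from both ends and split
-- by parity, so all weights reduce to polynomial identities; and the labels of each kind of element
-- fill runs of consecutive odd or even numbers which together tile {1, …, 4n − 1}. Hitting every
-- label already forces bijectivity, by pigeonhole. The lower bound is immediate: adjacent vertices
-- need distinct weights.

module Submission where

open import Defs
open import Data.Bool using (false; if_then_else_; _∨_)
open import Data.Bool.Properties using (∨-identityʳ)
open import Data.Fin using (Fin; zero; suc; toℕ; fromℕ<; inject₁; splitAt; join; _↑ˡ_; _↑ʳ_; punchOut)
open import Data.Fin.Properties
  using (_≟_; any?; toℕ-injective; toℕ-fromℕ<; toℕ-inject₁; toℕ-↑ˡ; toℕ-↑ʳ; toℕ<n;
         ↑ˡ-injective; ↑ʳ-injective; splitAt-↑ˡ; splitAt-↑ʳ; splitAt-join; join-splitAt;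
         punchOut-injective; injective⇒≤)
open import Data.List using (List; []; _∷_; _++_; map; tabulate; allFin; length; deduplicate)
open import Data.List.Properties using (map-tabulate; tabulate-cong)
open import Data.List.Membership.Propositional using (_∈_)
open import Data.List.Membership.Propositional.Properties using (∈-deduplicate⁺; ∈-map⁺; ∈-allFin)
open import Data.List.Relation.Unary.All using (All; _∷_)
import Data.List.Relation.Unary.All as All
import Data.List.Relation.Unary.All.Properties as All
open import Data.List.Relation.Unary.AllPairs using (_∷_)
open import Data.List.Relation.Unary.Any using (here; there)
open import Data.List.Relation.Unary.Unique.Propositional using (Unique)
open import Data.List.Relation.Unary.Unique.DecPropositional.Properties using (deduplicate-!)
open import Data.Nat using (ℕ; zero; suc; _+_; _*_; _∸_; _≤_; _<_; _≥_; z≤n; s≤s; _<?_)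
open import Data.Nat.ListAction using (sum)
open import Data.Nat.ListAction.Properties using (sum-++)
open import Data.Nat.Properties
  using (suc-injective; +-suc; +-assoc; +-identityʳ; +-mono-≤; +-cancelˡ-<; +-cancelˡ-≡;
         m≤m+n; n≤1+n; m+n∸m≡n; m+[n∸m]≡n; <⇒≢; <⇒≱; ≮⇒≥; 1+n≰n; ≤-trans; ≤-pred; ≤-antisym;
         m≤n⇒∃[o]m+o≡n)
  renaming (_≟_ to _≟ℕ_)
open import Data.Parity.Base using (Parity; 0ℙ; 1ℙ; _⁻¹)
open import Data.Product using (Σ; ∃; _×_; _,_; proj₁; proj₂)
open import Data.Sum using (_⊎_; inj₁; inj₂; [_,_]′; swap)
open import Function using (_∘_; id)
open import Function.Bundles using (_↣_; _⤖_; Injection; Bijection; mk↣; mk⤖)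
open import Function.Definitions using (Injective)
open import Relation.Binary.PropositionalEquality
open import Relation.Nullary using (yes; no; does; contradiction)
open import Relation.Nullary.Decidable using (⌊_⌋; isYes≗does; dec-true; dec-false)
open import Data.Nat.Tactic.RingSolver using (solve-∀)

sum-tabulate-0 : ∀ n → sum (tabulate {n = n} λ _ → 0) ≡ 0
sum-tabulate-0 zero    = refl
sum-tabulate-0 (suc n) = sum-tabulate-0 n

tabulate-↑ : ∀ {A : Set} m {n} (f : Fin (m + n) → A) →
             tabulate f ≡ tabulate (f ∘ (_↑ˡ n)) ++ tabulate (f ∘ (m ↑ʳ_))
tabulate-↑ zero    f = refl
tabulate-↑ (suc m) f = cong (f zero ∷_) (tabulate-↑ m (f ∘ suc))

sum-tabulate-cong : ∀ {n} {f g : Fin n → ℕ} → (∀ i → f i ≡ g i) → sum (tabulate f) ≡ sum (tabulate g)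
sum-tabulate-cong f≗g = cong sum (tabulate-cong f≗g)

sum-tabulate-↑ : ∀ m {n} (f : Fin (m + n) → ℕ) →
                 sum (tabulate f) ≡ sum (tabulate (f ∘ (_↑ˡ n))) + sum (tabulate (f ∘ (m ↑ʳ_)))
sum-tabulate-↑ m {n} f = trans (cong sum (tabulate-↑ m f)) (sum-++ (tabulate (f ∘ (_↑ˡ n))) _)

sum-tabulate-δ : ∀ {n} (i : Fin n) (f : Fin n → ℕ) →
                 sum (tabulate λ j → if does (i ≟ j) then f j else 0) ≡ f i
sum-tabulate-δ {suc n} zero f = trans (cong (f zero +_) (sum-tabulate-0 n)) (+-identityʳ (f zero))
sum-tabulate-δ (suc i) f = sum-tabulate-δ i (f ∘ suc)

-- With g t s the label of the path edge that has t edges before it and s after it, these are the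
-- labels of the path edges at the vertex that has t vertices before it and s after it.
before after : (ℕ → ℕ → ℕ) → ℕ → ℕ → ℕ
before g zero    s = 0
before g (suc t) s = g t s
after g t zero    = 0
after g t (suc s) = g t s

after-suc : ∀ g t s → after (λ t → g (suc t)) t s ≡ after g (suc t) s
after-suc g t zero    = refl
after-suc g t (suc s) = refl

sum-tabulate-path : ∀ k (g : ℕ → ℕ → ℕ) (i : Fin (suc k)) →
  sum (tabulate λ j → if does (i ≟ inject₁ j) ∨ does (i ≟ suc j) then g (toℕ j) (k ∸ suc (toℕ j)) else 0)
  ≡ before g (toℕ i) (k ∸ toℕ i) + after g (toℕ i) (k ∸ toℕ i)
sum-tabulate-path zero    g zero    = refl
sum-tabulate-path (suc k) g zero    = trans (cong (g 0 k +_) (sum-tabulate-0 k)) (+-identityʳ (g 0 k))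
sum-tabulate-path (suc k) g (suc i) = begin
  first + sum (tabulate λ j →
            if does (i ≟ inject₁ j) ∨ does (i ≟ suc j) then g′ (toℕ j) (k ∸ suc (toℕ j)) else 0)
    ≡⟨ cong (first +_) (sum-tabulate-path k g′ i) ⟩
  first + (before g′ t s + after g′ t s)
    ≡⟨ sym (+-assoc first _ _) ⟩
  (first + before g′ t s) + after g′ t s
    ≡⟨ cong₂ _+_ (first-before i) (after-suc g t s) ⟩
  g t s + after g (suc t) s ∎
  where
  open ≡-Reasoning
  g′ : ℕ → ℕ → ℕ
  g′ t = g (suc t)
  t s first : ℕ
  t = toℕ i
  s = k ∸ toℕ i
  first = if does (i ≟ zero) then g 0 k else 0
  first-before : ∀ i → (if does (i ≟ zero) then g 0 k else 0) + before g′ (toℕ i) (k ∸ toℕ i)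
                     ≡ g (toℕ i) (k ∸ toℕ i)
  first-before zero    = +-identityʳ (g 0 k)
  first-before (suc i) = refl

position : Parity → ℕ → ℕ
position 0ℙ j = j + j
position 1ℙ j = suc (j + j)

step : Parity × ℕ → Parity × ℕ
step (0ℙ , j) = 1ℙ , j
step (1ℙ , j) = 0ℙ , suc j

coordinates : ℕ → Parity × ℕ
coordinates zero    = 0ℙ , 0
coordinates (suc t) = step (coordinates t)

position-coordinates : ∀ t → position (proj₁ (coordinates t)) (proj₂ (coordinates t)) ≡ t
position-coordinates zero = refl
position-coordinates (suc t) with coordinates t | position-coordinates t
... | 0ℙ , j | eq = cong suc eq
... | 1ℙ , j | eq = cong suc (trans (+-suc j j) eq)

coordinates-position : ∀ π j → coordinates (position π j) ≡ (π , j)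
coordinates-position 0ℙ zero = refl
coordinates-position 1ℙ zero = refl
coordinates-position 0ℙ (suc j) rewrite +-suc j j | coordinates-position 0ℙ j = refl
coordinates-position 1ℙ (suc j) rewrite +-suc j j | coordinates-position 0ℙ j = refl

parity-suc : ∀ t → proj₁ (coordinates (suc t)) ≡ proj₁ (coordinates t) ⁻¹
parity-suc t with coordinates t
... | 0ℙ , j = refl
... | 1ℙ , j = refl

even≢odd : ∀ m n → m + m ≢ suc (n + n)
even≢odd zero    n       ()
even≢odd (suc m) zero    eq = contradiction (trans (sym (+-suc m m)) (suc-injective eq)) λ ()
even≢odd (suc m) (suc n) eq =
  even≢odd m n (suc-injective (suc-injective (trans (sym (double-suc m)) (trans eq (cong suc (double-suc n))))))
  where
  double-suc : ∀ m → suc m + suc m ≡ suc (suc (m + m))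
  double-suc m = cong suc (+-suc m m)

injective⇒surjective : ∀ {n} {f : Fin n → Fin n} → Injective _≡_ _≡_ f → ∀ y → ∃ λ x → f x ≡ y
injective⇒surjective {suc n} {f} f-injective y with any? (λ x → f x ≟ y)
... | yes found = found
... | no missed = contradiction (injective⇒≤ squeeze-injective) 1+n≰n
  where
  y≢f : ∀ x → y ≢ f x
  y≢f x y≡fx = missed (x , sym y≡fx)
  squeeze : Fin (suc n) → Fin n
  squeeze x = punchOut (y≢f x)
  squeeze-injective : Injective _≡_ _≡_ squeeze
  squeeze-injective {x} {x′} eq = f-injective (punchOut-injective (y≢f x) (y≢f x′) eq)

labelling-from-cover : ∀ {A : Set} {N} → A ↣ Fin N → (f : A → ℕ) →
                       (∀ L → L < N → ∃ λ x → f x ≡ suc L) →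
                       Σ (A ⤖ Fin N) λ g → ∀ x → suc (toℕ (Bijection.to g x)) ≡ f x
labelling-from-cover ι f cover = mk⤖ (from-injective , from-surjective) , label-from
  where
  h : Fin _ → _
  h L = proj₁ (cover (toℕ L) (toℕ<n L))
  f∘h : ∀ L → f (h L) ≡ suc (toℕ L)
  f∘h L = proj₂ (cover (toℕ L) (toℕ<n L))
  h-injective : Injective _≡_ _≡_ h
  h-injective {L} {L′} eq = toℕ-injective (suc-injective (trans (sym (f∘h L)) (trans (cong f eq) (f∘h L′))))
  preimage : ∀ x → ∃ λ L → h L ≡ x
  preimage x with injective⇒surjective (h-injective ∘ Injection.injective ι) (Injection.to ι x)
  ... | L , ιhL≡ιx = L , Injection.injective ι ιhL≡ιx
  from : _ → Fin _
  from x = proj₁ (preimage x)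
  h∘from : ∀ x → h (from x) ≡ x
  h∘from x = proj₂ (preimage x)
  from-injective : Injective _≡_ _≡_ from
  from-injective {x} {y} eq = trans (sym (h∘from x)) (trans (cong h eq) (h∘from y))
  from-surjective : ∀ L → ∃ λ x → ∀ {z} → z ≡ x → from z ≡ L
  from-surjective L = h L , λ { refl → h-injective (h∘from (h L)) }
  label-from : ∀ x → suc (toℕ (from x)) ≡ f x
  label-from x = trans (sym (f∘h (from x))) (cong f (h∘from x))

two-of-three : ∀ {a b x y z : ℕ} → x ≡ a ⊎ x ≡ b → y ≡ a ⊎ y ≡ b → z ≡ a ⊎ z ≡ b →
               x ≡ y ⊎ x ≡ z ⊎ y ≡ z
two-of-three (inj₁ p) (inj₁ q) _        = inj₁ (trans p (sym q))
two-of-three (inj₂ p) (inj₂ q) _        = inj₁ (trans p (sym q))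
two-of-three (inj₁ p) (inj₂ q) (inj₁ r) = inj₂ (inj₁ (trans p (sym r)))
two-of-three (inj₁ p) (inj₂ q) (inj₂ r) = inj₂ (inj₂ (trans q (sym r)))
two-of-three (inj₂ p) (inj₁ q) (inj₁ r) = inj₂ (inj₂ (trans q (sym r)))
two-of-three (inj₂ p) (inj₁ q) (inj₂ r) = inj₂ (inj₁ (trans p (sym r)))

length≤2 : ∀ {a b} {xs : List ℕ} → Unique xs → All (λ z → z ≡ a ⊎ z ≡ b) xs → length xs ≤ 2
length≤2 {xs = []}             _ _ = z≤n
length≤2 {xs = _ ∷ []}         _ _ = s≤s z≤n
length≤2 {xs = _ ∷ _ ∷ []}     _ _ = s≤s (s≤s z≤n)
length≤2 {xs = _ ∷ _ ∷ _ ∷ _} ((x≢y ∷ x≢z ∷ _) ∷ (y≢z ∷ _) ∷ _) (px ∷ py ∷ pz ∷ _)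
  with two-of-three px py pz
... | inj₁ x≡y        = contradiction x≡y x≢y
... | inj₂ (inj₁ x≡z) = contradiction x≡z x≢z
... | inj₂ (inj₂ y≡z) = contradiction y≡z y≢z

2≤length : ∀ {xs : List ℕ} {x y} → x ∈ xs → y ∈ xs → x ≢ y → 2 ≤ length xs
2≤length (here refl) (here refl) x≢y = contradiction refl x≢y
2≤length {_ ∷ _ ∷ _} (here _)  (there _) _ = s≤s (s≤s z≤n)
2≤length {_ ∷ _ ∷ _} (there _) _         _ = s≤s (s≤s z≤n)
2≤length {_ ∷ []}    (here _)  (there ()) _
2≤length {_ ∷ []}    (there ()) _         _

module Colours (G : Graph) (g : TotalLabeling G) where

  colours : List ℕ
  colours = deduplicate _≟ℕ_ (map (ωt G g) (allFin (nV G)))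

  ∈-colours : ∀ w → ωt G g w ∈ colours
  ∈-colours w = ∈-deduplicate⁺ _≟ℕ_ (∈-map⁺ (ωt G g) (∈-allFin w))

  atLeastTwoColours : IsLocalAntimagicTotal G g → Fin (nE G) → 2 ≤ numColours G g
  atLeastTwoColours antimagic e = 2≤length (∈-colours _) (∈-colours _) (antimagic e)

  exactlyTwoColours : ∀ {a b} → a ≢ b → (∀ w → ωt G g w ≡ a ⊎ ωt G g w ≡ b) →
                      ∃ (λ w → ωt G g w ≡ a) → ∃ (λ w → ωt G g w ≡ b) → numColours G g ≡ 2
  exactlyTwoColours a≢b two-valued (x , ωx≡a) (y , ωy≡b) = ≤-antisym
    (length≤2 (deduplicate-! _≟ℕ_ _)
              (All.deduplicate⁺ _≟ℕ_ (All.map⁺ (All.tabulate two-valued-allFin))))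
    (2≤length (subst (_∈ colours) ωx≡a (∈-colours x)) (subst (_∈ colours) ωy≡b (∈-colours y)) a≢b)
    where
    two-valued-allFin : ∀ {w} → w ∈ allFin (nV G) → ωt G g w ≡ _ ⊎ ωt G g w ≡ _
    two-valued-allFin {w} _ = two-valued w

↑-cases : ∀ {m n} (P : Fin (m + n) → Set) →
          (∀ i → P (i ↑ˡ n)) → (∀ j → P (m ↑ʳ j)) → ∀ x → P x
↑-cases {m} {n} P left right x with splitAt m x | join-splitAt m n x
... | inj₁ i | eq = subst P eq (left i)
... | inj₂ j | eq = subst P eq (right j)

join-injective : ∀ m n → Injective _≡_ _≡_ (join m n)
join-injective m n {x} {y} eq = trans (sym (splitAt-join m n x)) (trans (cong (splitAt m) eq) (splitAt-join m n y))

↑ˡ≢↑ʳ : ∀ {m n} (i : Fin m) (j : Fin n) → i ↑ˡ n ≢ m ↑ʳ j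
↑ˡ≢↑ʳ {m} {n} i j eq =
  <⇒≢ (≤-trans (toℕ<n i) (m≤m+n m (toℕ j)))
      (trans (sym (toℕ-↑ˡ i n)) (trans (cong toℕ eq) (toℕ-↑ʳ m j)))

does-injective : ∀ {m n} {f : Fin m → Fin n} → Injective _≡_ _≡_ f →
                 ∀ a b → does (f a ≟ f b) ≡ does (a ≟ b)
does-injective {f = f} f-injective a b with a ≟ b
... | yes refl = dec-true (f a ≟ f a) refl
... | no a≢b   = dec-false (f a ≟ f b) (a≢b ∘ f-injective)

locate : ∀ {n} t s → suc (t + s) ≡ n → Σ (Fin n) λ i → toℕ i ≡ t × n ∸ suc (toℕ i) ≡ s
locate t s refl =
  fromℕ< t<1+t+s , toℕ-fromℕ< t<1+t+s , trans (cong (t + s ∸_) (toℕ-fromℕ< t<1+t+s)) (m+n∸m≡n t s)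
  where
  t<1+t+s : t < suc (t + s)
  t<1+t+s = s≤s (m≤m+n t s)

halve-< : ∀ {r m} → r + r < suc m + m → r < suc m
halve-< {r} {m} r+r< with r <? suc m
... | yes r<1+m = r<1+m
... | no r≮1+m  =
  contradiction (+-mono-≤ (≮⇒≥ r≮1+m) (≤-trans (n≤1+n m) (≮⇒≥ r≮1+m))) (<⇒≱ r+r<)

halve-<′ : ∀ {r m} → suc (r + r) < suc m + m → r < m
halve-<′ {r} {m} r+r< with r <? m
... | yes r<m = r<m
... | no r≮m  = contradiction (s≤s (+-mono-≤ (≮⇒≥ r≮m) (≮⇒≥ r≮m))) (<⇒≱ r+r<)

-- The path vertices v_i, pendant vertices u_i, path edges v_i v_{i+1} and pendant edges u_i v_i.
data Element : Set where
  v u vv uv : Element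

-- S e π j s is the label of the element of kind e that has 2 j + π elements of its kind before it
-- and s after it.
Scheme : Set
Scheme = Element → Parity → ℕ → ℕ → ℕ

count : Element → ℕ → ℕ
count vv k = k
count _  k = suc k

colour : Parity → ℕ → ℕ → ℕ
colour 0ℙ a b = a
colour 1ℙ a b = b

colour-cases : ∀ {x a b} π → x ≡ colour π a b → x ≡ a ⊎ x ≡ b
colour-cases 0ℙ = inj₁
colour-cases 1ℙ = inj₂

colour-⁻¹ : ∀ {a b} π → a ≢ b → colour π a b ≢ colour (π ⁻¹) a b
colour-⁻¹ 0ℙ a≢b = a≢b
colour-⁻¹ 1ℙ a≢b = a≢b ∘ sym

colour-swap : ∀ {a b} π → a ≢ b → colour π b a ≢ colour π a b
colour-swap 0ℙ a≢b = a≢b ∘ sym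
colour-swap 1ℙ a≢b = a≢b

edgeBefore edgeAfter : Scheme → Parity → ℕ → ℕ → ℕ
edgeBefore S 0ℙ zero    s = 0
edgeBefore S 0ℙ (suc j) s = S vv 1ℙ j s
edgeBefore S 1ℙ j       s = S vv 0ℙ j s
edgeAfter S π j zero    = 0
edgeAfter S π j (suc s) = S vv π j s

spineWeight leafWeight : Scheme → Parity → ℕ → ℕ → ℕ
spineWeight S π j s = S v π j s + ((edgeBefore S π j s + edgeAfter S π j s) + S uv π j s)
leafWeight  S π j s = S u π j s + S uv π j s

record Weighted (S : Scheme) (π : Parity) (j s a b : ℕ) : Set where
  constructor weighted
  field
    spineWeighted : spineWeight S π j s ≡ colour π a b
    leafWeighted  : leafWeight S π j s ≡ colour π b a

Balanced : Scheme → ℕ → ℕ → ℕ → Set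
Balanced S k a b = ∀ π j s → position π j + s ≡ k → Weighted S π j s a b

weighted-at : ∀ {S π j s k} (α β : ℕ → ℕ) → position π j + s ≡ k →
              Weighted S π j s (α (position π j + s)) (β (position π j + s)) → Weighted S π j s (α k) (β k)
weighted-at α β refl w = w

record Hit (S : Scheme) (k ℓ : ℕ) : Set where
  constructor hit
  field
    element     : Element
    parity      : Parity
    half        : ℕ
    coposition  : ℕ
    fits        : suc (position parity half + coposition) ≡ count element k
    labelled    : S element parity half coposition ≡ ℓ

record Segment (S : Scheme) (k : ℕ) (f : ℕ → ℕ) (a n : ℕ) : Set where
  field
    hitAt : ∀ x → x < n → Hit S k (f (a + x))
open Segment using (hitAt)

infixr 5 _▹_

_▹_ : ∀ {S k f a m n} → Segment S k f a m → Segment S k f (a + m) n → Segment S k f a (m + n)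
(_▹_ {S} {k} {f} {a} {m} {n} front back) .hitAt x x<m+n with x <? m
... | yes x<m = front .hitAt x x<m
... | no x≮m with (y , refl) ← m≤n⇒∃[o]m+o≡n (≮⇒≥ x≮m) =
  subst (Hit S k ∘ f) (+-assoc a m y) (back .hitAt y (+-cancelˡ-< m y n x<m+n))

point : ∀ {S k f a} → Hit S k (f a) → Segment S k f a 1
point {S} {k} {f} {a} h .hitAt zero    _ = subst (Hit S k ∘ f) (sym (+-identityʳ a)) h
point                 h .hitAt (suc _) (s≤s ())

resize : ∀ {S k f a m n} → Segment S k f a m → m ≡ n → Segment S k f a n
resize segment refl = segment

oddLabel evenLabel : ℕ → ℕ
oddLabel  r = suc (r + r)
evenLabel r = suc (suc (r + r))

Covers : Scheme → ℕ → Set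
Covers S k = Segment S k oddLabel 0 (suc k + suc k) × Segment S k evenLabel 0 (k + suc k)

module Firecracker (k : ℕ) where

  F : Graph
  F = firecracker1 (suc k)

  spine leaf : Fin (suc k) → Fin (nV F)
  spine i = i ↑ˡ suc k
  leaf  i = suc k ↑ʳ i

  spineEdge : Fin k → Fin (nE F)
  spineEdge j = j ↑ˡ suc k

  pendantEdge : Fin (suc k) → Fin (nE F)
  pendantEdge i = k ↑ʳ i

  ends-spineEdge : ∀ j → ends F (spineEdge j) ≡ (spine (inject₁ j) , spine (suc j))
  ends-spineEdge j rewrite splitAt-↑ˡ k j (suc k) = refl

  ends-pendantEdge : ∀ i → ends F (pendantEdge i) ≡ (leaf i , spine i)
  ends-pendantEdge i rewrite splitAt-↑ʳ k (suc k) i = refl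

  incident-ends : ∀ w {e a b} → ends F e ≡ (a , b) → incident F w e ≡ does (w ≟ a) ∨ does (w ≟ b)
  incident-ends w {e} {a} {b} eq = trans (cong (λ p → ⌊ w ≟ proj₁ p ⌋ ∨ ⌊ w ≟ proj₂ p ⌋) eq)
                                        (cong₂ _∨_ (isYes≗does (w ≟ a)) (isYes≗does (w ≟ b)))

  spine-injective : Injective _≡_ _≡_ spine
  spine-injective = ↑ˡ-injective (suc k) _ _

  leaf-injective : Injective _≡_ _≡_ leaf
  leaf-injective = ↑ʳ-injective (suc k) _ _

  incident-spine-spineEdge : ∀ i j →
    incident F (spine i) (spineEdge j) ≡ does (i ≟ inject₁ j) ∨ does (i ≟ suc j)
  incident-spine-spineEdge i j = trans (incident-ends (spine i) (ends-spineEdge j))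
    (cong₂ _∨_ (does-injective spine-injective i (inject₁ j)) (does-injective spine-injective i (suc j)))

  incident-spine-pendantEdge : ∀ i i′ → incident F (spine i) (pendantEdge i′) ≡ does (i ≟ i′)
  incident-spine-pendantEdge i i′ = trans (incident-ends (spine i) (ends-pendantEdge i′))
    (cong₂ _∨_ (dec-false (spine i ≟ leaf i′) (↑ˡ≢↑ʳ i i′)) (does-injective spine-injective i i′))

  incident-leaf-spineEdge : ∀ i j → incident F (leaf i) (spineEdge j) ≡ false
  incident-leaf-spineEdge i j = trans (incident-ends (leaf i) (ends-spineEdge j))
    (cong₂ _∨_ (dec-false (leaf i ≟ spine (inject₁ j)) (↑ˡ≢↑ʳ (inject₁ j) i ∘ sym))
               (dec-false (leaf i ≟ spine (suc j)) (↑ˡ≢↑ʳ (suc j) i ∘ sym)))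

  incident-leaf-pendantEdge : ∀ i i′ → incident F (leaf i) (pendantEdge i′) ≡ does (i ≟ i′)
  incident-leaf-pendantEdge i i′ = trans (incident-ends (leaf i) (ends-pendantEdge i′))
    (trans (cong₂ _∨_ (does-injective leaf-injective i i′)
                      (dec-false (leaf i ≟ spine i′) (↑ˡ≢↑ʳ i′ i ∘ sym)))
           (∨-identityʳ _))

  ωt-split : ∀ g w → ωt F g w ≡ label F g (inj₁ w) +
    (sum (tabulate λ j → if incident F w (spineEdge j) then label F g (inj₂ (spineEdge j)) else 0) +
     sum (tabulate λ i → if incident F w (pendantEdge i) then label F g (inj₂ (pendantEdge i)) else 0))
  ωt-split g w = cong (label F g (inj₁ w) +_)
    (trans (cong sum (map-tabulate id incidentLabel)) (sum-tabulate-↑ k incidentLabel))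
    where
    incidentLabel : Fin (nE F) → ℕ
    incidentLabel e = if incident F w e then label F g (inj₂ e) else 0

  module Labelled (S : Scheme) where

    at : Element → ℕ → ℕ → ℕ
    at e t s = S e (proj₁ (coordinates t)) (proj₂ (coordinates t)) s

    labelAt : (e : Element) → Fin (count e k) → ℕ
    labelAt e i = at e (toℕ i) (count e k ∸ suc (toℕ i))

    element : (e : Element) → Fin (count e k) → Fin (nV F) ⊎ Fin (nE F)
    element v  i = inj₁ (spine i)
    element u  i = inj₁ (leaf i)
    element vv j = inj₂ (spineEdge j)
    element uv i = inj₂ (pendantEdge i)

    schemeLabel : Fin (nV F) ⊎ Fin (nE F) → ℕ
    schemeLabel (inj₁ w) = [ labelAt v , labelAt u ]′ (splitAt (suc k) w)
    schemeLabel (inj₂ e) = [ labelAt vv , labelAt uv ]′ (splitAt k e)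

    schemeLabel-element : ∀ e i → schemeLabel (element e i) ≡ labelAt e i
    schemeLabel-element v  i rewrite splitAt-↑ˡ (suc k) i (suc k) = refl
    schemeLabel-element u  i rewrite splitAt-↑ʳ (suc k) (suc k) i = refl
    schemeLabel-element vv j rewrite splitAt-↑ˡ k j (suc k)       = refl
    schemeLabel-element uv i rewrite splitAt-↑ʳ k (suc k) i       = refl

    hit⇒element : ∀ {ℓ} → Hit S k ℓ → ∃ λ x → schemeLabel x ≡ ℓ
    hit⇒element (hit e π j s fits labelled) with locate (position π j) s fits
    ... | i , i≡t , s≡ = element e i , trans (schemeLabel-element e i) (trans at≡ labelled)
      where
      at≡ : labelAt e i ≡ S e π j s
      at≡ = trans (cong₂ (at e) i≡t s≡)
                  (cong (λ c → S e (proj₁ c) (proj₂ c) s) (coordinates-position π j))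

    covers⇒surjective : Covers S k → ∀ L → L < nV F + nE F → ∃ λ x → schemeLabel x ≡ suc L
    covers⇒surjective (odd , even) L L<N with coordinates L | position-coordinates L
    ... | 0ℙ , r | refl = hit⇒element (odd .hitAt r (halve-< L<N))
    ... | 1ℙ , r | refl = hit⇒element (even .hitAt r (halve-<′ L<N))

    before-coordinates : ∀ t s → let c = coordinates t in
                         before (at vv) t s ≡ edgeBefore S (proj₁ c) (proj₂ c) s
    before-coordinates zero    s = refl
    before-coordinates (suc t) s with coordinates t
    ... | 0ℙ , j = refl
    ... | 1ℙ , j = refl

    after-coordinates : ∀ t s → let c = coordinates t in
                        after (at vv) t s ≡ edgeAfter S (proj₁ c) (proj₂ c) s
    after-coordinates t zero    = refl
    after-coordinates t (suc s) = refl

    module Weights (g : TotalLabeling F) (agrees : ∀ x → label F g x ≡ schemeLabel x) where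

      label-element : ∀ e i → label F g (element e i) ≡ labelAt e i
      label-element e i = trans (agrees (element e i)) (schemeLabel-element e i)

      pendantEdge-sum : ∀ w i → (∀ i′ → incident F w (pendantEdge i′) ≡ does (i ≟ i′)) →
        sum (tabulate λ i′ → if incident F w (pendantEdge i′) then label F g (inj₂ (pendantEdge i′)) else 0)
        ≡ labelAt uv i
      pendantEdge-sum w i incidence = trans
        (sum-tabulate-cong λ i′ →
          cong (λ b → if b then label F g (inj₂ (pendantEdge i′)) else 0) (incidence i′))
        (trans (sum-tabulate-δ i λ i′ → label F g (inj₂ (pendantEdge i′))) (label-element uv i))

      ωt-spine : ∀ i → let c = coordinates (toℕ i) in
                 ωt F g (spine i) ≡ spineWeight S (proj₁ c) (proj₂ c) (k ∸ toℕ i)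
      ωt-spine i = trans (ωt-split g (spine i)) (cong₂ _+_ (label-element v i)
        (cong₂ _+_ spineEdge-sum (pendantEdge-sum (spine i) i (incident-spine-pendantEdge i))))
        where
        t s : ℕ
        c : Parity × ℕ
        t = toℕ i
        s = k ∸ toℕ i
        c = coordinates t
        spineEdge-sum : sum (tabulate λ j →
                          if incident F (spine i) (spineEdge j) then label F g (inj₂ (spineEdge j)) else 0)
                        ≡ edgeBefore S (proj₁ c) (proj₂ c) s + edgeAfter S (proj₁ c) (proj₂ c) s
        spineEdge-sum = begin
          _ ≡⟨ sum-tabulate-cong (λ j → cong₂ (λ b x → if b then x else 0)
                                               (incident-spine-spineEdge i j) (label-element vv j)) ⟩
          _ ≡⟨ sum-tabulate-path k (at vv) i ⟩
          _ ≡⟨ cong₂ _+_ (before-coordinates t s) (after-coordinates t s) ⟩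
          _ ∎
          where open ≡-Reasoning

      ωt-leaf : ∀ i → let c = coordinates (toℕ i) in
                ωt F g (leaf i) ≡ leafWeight S (proj₁ c) (proj₂ c) (k ∸ toℕ i)
      ωt-leaf i = trans (ωt-split g (leaf i)) (cong₂ _+_ (label-element u i)
        (cong₂ _+_ spineEdge-sum (pendantEdge-sum (leaf i) i (incident-leaf-pendantEdge i))))
        where
        spineEdge-sum : sum (tabulate λ j →
                          if incident F (leaf i) (spineEdge j) then label F g (inj₂ (spineEdge j)) else 0) ≡ 0
        spineEdge-sum = trans
          (sum-tabulate-cong λ j →
            cong (λ b → if b then label F g (inj₂ (spineEdge j)) else 0) (incident-leaf-spineEdge i j))
          (sum-tabulate-0 k)

      module Colouring {α β} (α≢β : α ≢ β) (balanced : Balanced S k α β) where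

        parityOf : Fin (suc k) → Parity
        parityOf i = proj₁ (coordinates (toℕ i))

        weighted-vertex : ∀ i → Weighted S (parityOf i) (proj₂ (coordinates (toℕ i))) (k ∸ toℕ i) α β
        weighted-vertex i = balanced _ _ _
          (trans (cong (_+ (k ∸ toℕ i)) (position-coordinates (toℕ i))) (m+[n∸m]≡n (≤-pred (toℕ<n i))))

        spine-colour : ∀ i → ωt F g (spine i) ≡ colour (parityOf i) α β
        spine-colour i = trans (ωt-spine i) (Weighted.spineWeighted (weighted-vertex i))

        leaf-colour : ∀ i → ωt F g (leaf i) ≡ colour (parityOf i) β α
        leaf-colour i = trans (ωt-leaf i) (Weighted.leafWeighted (weighted-vertex i))

        parityOf-suc : ∀ j → parityOf (suc j) ≡ parityOf (inject₁ j) ⁻¹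
        parityOf-suc j =
          trans (parity-suc (toℕ j)) (cong (λ t → proj₁ (coordinates t) ⁻¹) (sym (toℕ-inject₁ j)))

        spineEdge-proper : ∀ j → ωt F g (spine (inject₁ j)) ≢ ωt F g (spine (suc j))
        spineEdge-proper j eq = colour-⁻¹ (parityOf (inject₁ j)) α≢β (begin
          colour (parityOf (inject₁ j)) α β    ≡⟨ spine-colour (inject₁ j) ⟨
          ωt F g (spine (inject₁ j))           ≡⟨ eq ⟩
          ωt F g (spine (suc j))               ≡⟨ spine-colour (suc j) ⟩
          colour (parityOf (suc j)) α β        ≡⟨ cong (λ π → colour π α β) (parityOf-suc j) ⟩
          colour (parityOf (inject₁ j) ⁻¹) α β ∎)
          where open ≡-Reasoning

        pendantEdge-proper : ∀ i → ωt F g (leaf i) ≢ ωt F g (spine i)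
        pendantEdge-proper i eq =
          colour-swap (parityOf i) α≢β (trans (sym (leaf-colour i)) (trans eq (spine-colour i)))

        antimagic : IsLocalAntimagicTotal F g
        antimagic = ↑-cases (λ e → proper (ends F e))
          (λ j → subst proper (sym (ends-spineEdge j)) (spineEdge-proper j))
          (λ i → subst proper (sym (ends-pendantEdge i)) (pendantEdge-proper i))
          where
          proper : Fin (nV F) × Fin (nV F) → Set
          proper (a , b) = ωt F g a ≢ ωt F g b

        two-valued : ∀ w → ωt F g w ≡ α ⊎ ωt F g w ≡ β
        two-valued = ↑-cases (λ w → ωt F g w ≡ α ⊎ ωt F g w ≡ β)
          (λ i → colour-cases (parityOf i) (spine-colour i))
          (λ i → swap (colour-cases (parityOf i) (leaf-colour i)))

  chiLat≡2 : (S : Scheme) {α β : ℕ} → α ≢ β → Balanced S k α β → Covers S k → IsChiLat F 2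
  chiLat≡2 S {α} {β} α≢β balanced covers =
      (g , antimagic ,
       exactlyTwoColours α≢β two-valued (spine zero , spine-colour zero) (leaf zero , leaf-colour zero))
    , λ g′ antimagic′ → Colours.atLeastTwoColours F g′ antimagic′ (pendantEdge zero)
    where
    open Labelled S

    labelling : Σ (TotalLabeling F) λ g → ∀ x → label F g x ≡ schemeLabel x
    labelling = labelling-from-cover (mk↣ (join-injective (nV F) (nE F))) schemeLabel (covers⇒surjective covers)

    g : TotalLabeling F
    g = proj₁ labelling

    open Weights g (proj₂ labelling)
    open Colouring α≢β balanced
    open Colours F g

-- Odd order n = 2 w + 1, i.e. k = w + w

module OddOrder where

  scheme : Scheme
  scheme v  0ℙ j zero      = 6 * j + 1
  scheme v  0ℙ j s@(suc _) = 4 * j + s + 1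
  scheme v  1ℙ j s         = s
  scheme u  0ℙ j s         = 8 * j + 3 * s + 3
  scheme u  1ℙ j s         = 4 * j + 3 * s + 2
  scheme vv 0ℙ j s         = 2 * j + 2 * s + 2
  scheme vv 1ℙ j s         = 2 * j + 2
  scheme uv 0ℙ j s         = 4 * j + 3 * s + 2
  scheme uv 1ℙ j s         = 8 * j + 3 * s + 7

  α β : ℕ → ℕ
  α k = 6 * k + 3
  β k = 6 * k + 5

  α≢β : ∀ k → α k ≢ β k
  α≢β k eq with () ← +-cancelˡ-≡ (6 * k) 3 5 eq

  leaf₀ : ∀ j s → 8 * j + 3 * s + 3 + (4 * j + 3 * s + 2) ≡ 6 * (j + j + s) + 5
  leaf₀ = solve-∀

  leaf₁ : ∀ j s → 4 * j + 3 * s + 2 + (8 * j + 3 * s + 7) ≡ 6 * (1 + (j + j) + s) + 3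
  leaf₁ = solve-∀

  balanced : ∀ w → Balanced scheme (w + w) (α (w + w)) (β (w + w))
  balanced w 0ℙ zero    zero    eq = weighted-at α β eq (weighted refl refl)
  balanced w 0ℙ zero    (suc s) eq = weighted-at α β eq (weighted (first s) (leaf₀ 0 (suc s)))
    where
    first : ∀ s → (1 + s) + 1 + ((2 * s + 2) + (3 * (1 + s) + 2)) ≡ 6 * (1 + s) + 3
    first = solve-∀
  balanced w 0ℙ (suc j) zero    eq = weighted-at α β eq (weighted (last j) (leaf₀ (suc j) 0))
    where
    last : ∀ j → 6 * (1 + j) + 1 + ((2 * j + 2 + 0) + (4 * (1 + j) + 3 * 0 + 2))
          ≡ 6 * ((1 + j) + (1 + j) + 0) + 3
    last = solve-∀
  balanced w 0ℙ (suc j) (suc s) eq = weighted-at α β eq (weighted (inner j s) (leaf₀ (suc j) (suc s)))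
    where
    inner : ∀ j s → 4 * (1 + j) + (1 + s) + 1
                    + ((2 * j + 2 + (2 * (1 + j) + 2 * s + 2)) + (4 * (1 + j) + 3 * (1 + s) + 2))
                    ≡ 6 * ((1 + j) + (1 + j) + (1 + s)) + 3
    inner = solve-∀
  balanced w 1ℙ j       zero    eq = contradiction (trans (sym eq) (+-identityʳ _)) (even≢odd w j)
  balanced w 1ℙ j       (suc s) eq = weighted-at α β eq (weighted (inner j s) (leaf₁ j (suc s)))
    where
    inner : ∀ j s → (1 + s) + ((2 * j + 2 * (1 + s) + 2 + (2 * j + 2)) + (8 * j + 3 * (1 + s) + 7))
                    ≡ 6 * (1 + (j + j) + (1 + s)) + 5
    inner = solve-∀

  fits-odd : ∀ x y → let w = 1 + (x + y) in 1 + (1 + (y + y) + (1 + (x + x))) ≡ 1 + (w + w)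
  fits-odd = solve-∀

  v₁ : ∀ w → Segment scheme (w + w) oddLabel 0 w
  v₁ w .hitAt x x<w with (y , refl) ← m≤n⇒∃[o]m+o≡n x<w = hit v 1ℙ y (suc (x + x)) (fits-odd x y) refl

  v₀ : ∀ w → Segment scheme (w + w) oddLabel w w
  v₀ w .hitAt x x<w with (y , refl) ← m≤n⇒∃[o]m+o≡n x<w =
    hit v 0ℙ x (suc y + suc y) (fits x y) (labelled x y)
    where
    fits : ∀ x y → let w = 1 + (x + y) in 1 + (x + x + ((1 + y) + (1 + y))) ≡ 1 + (w + w)
    fits = solve-∀
    labelled : ∀ x y → let w = 1 + (x + y) in 4 * x + ((1 + y) + (1 + y)) + 1 ≡ 1 + (w + x + (w + x))
    labelled = solve-∀

  u₁ : ∀ w → Segment scheme (w + w) oddLabel (w + w) w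
  u₁ w .hitAt x x<w with (y , refl) ← m≤n⇒∃[o]m+o≡n x<w =
    hit u 1ℙ y (suc (x + x)) (fits-odd x y) (labelled x y)
    where
    labelled : ∀ x y → let w = 1 + (x + y) ; r = w + w + x in 4 * y + 3 * (1 + (x + x)) + 2 ≡ 1 + (r + r)
    labelled = solve-∀

  v-last : ∀ w → Hit scheme (w + w) (oddLabel (w + w + w))
  v-last w = hit v 0ℙ w 0 (cong suc (+-identityʳ (w + w))) (labelled w)
    where
    labelled : ∀ w → let r = w + w + w in 6 * w + 1 ≡ 1 + (r + r)
    labelled = solve-∀

  u₀ : ∀ w → Segment scheme (w + w) oddLabel (w + w + w + 1) (suc w)
  u₀ w .hitAt x x≤w with (y , refl) ← m≤n⇒∃[o]m+o≡n x≤w = hit u 0ℙ x (y + y) (fits x y) (labelled x y)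
    where
    fits : ∀ x y → let w = x + y in 1 + (x + x + (y + y)) ≡ 1 + (w + w)
    fits = solve-∀
    labelled : ∀ x y → let w = x + y ; r = w + w + w + 1 + x in 8 * x + 3 * (y + y) + 3 ≡ 1 + (r + r)
    labelled = solve-∀

  vv₁ : ∀ w → Segment scheme (w + w) evenLabel 0 w
  vv₁ w .hitAt x x<w with (y , refl) ← m≤n⇒∃[o]m+o≡n x<w = hit vv 1ℙ x (y + y) (fits x y) (labelled x)
    where
    fits : ∀ x y → let w = 1 + (x + y) in 1 + (1 + (x + x) + (y + y)) ≡ w + w
    fits = solve-∀
    labelled : ∀ x → 2 * x + 2 ≡ 2 + (x + x)
    labelled = solve-∀

  vv₀ : ∀ w → Segment scheme (w + w) evenLabel w w
  vv₀ w .hitAt x x<w with (y , refl) ← m≤n⇒∃[o]m+o≡n x<w =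
    hit vv 0ℙ y (suc (x + x)) (fits x y) (labelled x y)
    where
    fits : ∀ x y → let w = 1 + (x + y) in 1 + (y + y + (1 + (x + x))) ≡ w + w
    fits = solve-∀
    labelled : ∀ x y → let r = 1 + (x + y) + x in 2 * y + 2 * (1 + (x + x)) + 2 ≡ 2 + (r + r)
    labelled = solve-∀

  uv₀ : ∀ w → Segment scheme (w + w) evenLabel (w + w) (suc w)
  uv₀ w .hitAt x x≤w with (y , refl) ← m≤n⇒∃[o]m+o≡n x≤w = hit uv 0ℙ y (x + x) (fits x y) (labelled x y)
    where
    fits : ∀ x y → let w = x + y in 1 + (y + y + (x + x)) ≡ 1 + (w + w)
    fits = solve-∀
    labelled : ∀ x y → let w = x + y ; r = w + w + x in 4 * y + 3 * (x + x) + 2 ≡ 2 + (r + r)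
    labelled = solve-∀

  uv₁ : ∀ w → Segment scheme (w + w) evenLabel (w + w + suc w) w
  uv₁ w .hitAt x x<w with (y , refl) ← m≤n⇒∃[o]m+o≡n x<w =
    hit uv 1ℙ x (suc (y + y)) (fits x y) (labelled x y)
    where
    fits : ∀ x y → let w = 1 + (x + y) in 1 + (1 + (x + x) + (1 + (y + y))) ≡ 1 + (w + w)
    fits = solve-∀
    labelled : ∀ x y → let w = 1 + (x + y) ; r = w + w + (1 + w) + x in
          8 * x + 3 * (1 + (y + y)) + 7 ≡ 2 + (r + r)
    labelled = solve-∀

  covers : ∀ w → Covers scheme (w + w)
  covers w = resize (v₁ w ▹ v₀ w ▹ u₁ w ▹ point (v-last w) ▹ u₀ w) (odd-total w)
           , resize (vv₁ w ▹ vv₀ w ▹ uv₀ w ▹ uv₁ w) (even-total w)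
    where
    odd-total : ∀ w → w + (w + (w + (1 + (1 + w)))) ≡ (1 + (w + w)) + (1 + (w + w))
    odd-total = solve-∀
    even-total : ∀ w → w + (w + ((1 + w) + w)) ≡ w + w + (1 + (w + w))
    even-total = solve-∀

-- Even order n = 2 w + 4, i.e. k = 2 w + 3

module EvenOrder where

  scheme : Scheme
  scheme vv 0ℙ j       s       = s + 1
  scheme vv 1ℙ j       s       = 2 * j + 2
  scheme uv 0ℙ zero    s       = 2 * s + 2
  scheme uv 0ℙ j       1       = 6 * j + 3
  scheme uv 0ℙ j       s       = 8 * j + 3 * s + 1
  scheme uv 1ℙ zero    s       = 2 * s + 1
  scheme uv 1ℙ j       0       = 4 * j
  scheme uv 1ℙ j       s       = 8 * j + 3 * s + 5
  scheme u  0ℙ zero    s       = 4 * s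
  scheme u  0ℙ j       1       = 6 * j + 5
  scheme u  0ℙ j       s       = 4 * j + 3 * s + 1
  scheme u  1ℙ zero    s       = 4 * s + 5
  scheme u  1ℙ j       0       = 8 * j + 6
  scheme u  1ℙ j       s       = 4 * j + 3 * s + 1
  scheme v  0ℙ zero    (suc s) = 3 * s + 1
  scheme v  0ℙ j       1       = 4 * j + 2
  scheme v  0ℙ j       (suc s) = 2 * j + 2 * s + 1
  scheme v  0ℙ j       zero    = 0    -- unused: as k is odd, a path vertex at even position has s odd
  scheme v  1ℙ zero    s       = 3 * s + 4
  scheme v  1ℙ j       0       = 8 * j + 7
  scheme v  1ℙ j       s       = 2 * j + 2 * s

  α β : ℕ → ℕ
  α k = 6 * k
  β k = 6 * k + 2

  α≢β : ∀ k → α k ≢ β k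
  α≢β k eq with () ← +-cancelˡ-≡ (6 * k) 0 2 (trans (+-identityʳ (6 * k)) eq)

  balanced : ∀ w → let k = suc (suc w + suc w) in Balanced scheme k (α k) (β k)
  balanced w 0ℙ j       zero          eq = contradiction (trans (sym (+-identityʳ _)) eq) (even≢odd j (suc w))
  balanced w 0ℙ zero    (suc s)       eq = weighted-at α β eq (weighted (spine s) (leaf s))
    where
    spine : ∀ s → 3 * s + 1 + ((s + 1) + (2 * (1 + s) + 2)) ≡ 6 * (1 + s)
    spine = solve-∀
    leaf : ∀ s → 4 * (1 + s) + (2 * (1 + s) + 2) ≡ 6 * (1 + s) + 2
    leaf = solve-∀
  balanced w 0ℙ (suc j) 1             eq = weighted-at α β eq (weighted (spine j) (leaf j))
    where
    spine : ∀ j → 4 * (1 + j) + 2 + ((2 * j + 2 + 1) + (6 * (1 + j) + 3)) ≡ 6 * ((1 + j) + (1 + j) + 1)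
    spine = solve-∀
    leaf : ∀ j → 6 * (1 + j) + 5 + (6 * (1 + j) + 3) ≡ 6 * ((1 + j) + (1 + j) + 1) + 2
    leaf = solve-∀
  balanced w 0ℙ (suc j) (suc (suc s)) eq = weighted-at α β eq (weighted (spine j s) (leaf j s))
    where
    spine : ∀ j s → 2 * (1 + j) + 2 * (1 + s) + 1
                    + ((2 * j + 2 + ((1 + s) + 1)) + (8 * (1 + j) + 3 * (2 + s) + 1))
                    ≡ 6 * ((1 + j) + (1 + j) + (2 + s))
    spine = solve-∀
    leaf : ∀ j s → 4 * (1 + j) + 3 * (2 + s) + 1 + (8 * (1 + j) + 3 * (2 + s) + 1)
          ≡ 6 * ((1 + j) + (1 + j) + (2 + s)) + 2
    leaf = solve-∀
  balanced w 1ℙ zero    zero          ()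
  balanced w 1ℙ zero    (suc s)       eq = weighted-at α β eq (weighted (spine s) (leaf s))
    where
    spine : ∀ s → 3 * (1 + s) + 4 + (((1 + s) + 1 + 2) + (2 * (1 + s) + 1)) ≡ 6 * (2 + s) + 2
    spine = solve-∀
    leaf : ∀ s → 4 * (1 + s) + 5 + (2 * (1 + s) + 1) ≡ 6 * (2 + s)
    leaf = solve-∀
  balanced w 1ℙ (suc j) zero          eq = weighted-at α β eq (weighted (spine j) (leaf j))
    where
    spine : ∀ j → 8 * (1 + j) + 7 + (1 + 4 * (1 + j)) ≡ 6 * (1 + ((1 + j) + (1 + j)) + 0) + 2
    spine = solve-∀
    leaf : ∀ j → 8 * (1 + j) + 6 + 4 * (1 + j) ≡ 6 * (1 + ((1 + j) + (1 + j)) + 0)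
    leaf = solve-∀
  balanced w 1ℙ (suc j) (suc s)       eq = weighted-at α β eq (weighted (spine j s) (leaf j s))
    where
    spine : ∀ j s → 2 * (1 + j) + 2 * (1 + s)
                    + (((1 + s) + 1 + (2 * (1 + j) + 2)) + (8 * (1 + j) + 3 * (1 + s) + 5))
                    ≡ 6 * (1 + ((1 + j) + (1 + j)) + (1 + s)) + 2
    spine = solve-∀
    leaf : ∀ j s → 4 * (1 + j) + 3 * (1 + s) + 1 + (8 * (1 + j) + 3 * (1 + s) + 5)
          ≡ 6 * (1 + ((1 + j) + (1 + j)) + (1 + s))
    leaf = solve-∀

  fits-penultimate : ∀ w → let k = 1 + ((1 + w) + (1 + w)) in 1 + ((1 + w) + (1 + w) + 1) ≡ 1 + k
  fits-penultimate = solve-∀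

  fits-last : ∀ w → let k = 1 + ((1 + w) + (1 + w)) in 1 + (1 + ((1 + w) + (1 + w)) + 0) ≡ 1 + k
  fits-last = solve-∀

  vv₀ : ∀ w → Segment scheme (suc (w + w)) oddLabel 0 (suc w)
  vv₀ w .hitAt x x≤w with (y , refl) ← m≤n⇒∃[o]m+o≡n x≤w = hit vv 0ℙ y (x + x) (fits x y) (labelled x)
    where
    fits : ∀ x y → let w = x + y in 1 + (y + y + (x + x)) ≡ 1 + (w + w)
    fits = solve-∀
    labelled : ∀ x → x + x + 1 ≡ 1 + (x + x)
    labelled = solve-∀

  v₀ : ∀ w → Segment scheme (suc (suc w + suc w)) oddLabel (suc (suc w)) w
  v₀ w .hitAt x x<w with (y , refl) ← m≤n⇒∃[o]m+o≡n x<w =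
    hit v 0ℙ (suc y) (suc (suc (suc (x + x)))) (fits x y) (labelled x y)
    where
    fits : ∀ x y → let w = 1 + (x + y) ; k = 1 + ((1 + w) + (1 + w)) in
          1 + ((1 + y) + (1 + y) + (3 + (x + x))) ≡ 1 + k
    fits = solve-∀
    labelled : ∀ x y → let w = 1 + (x + y) ; r = 2 + w + x in
          2 * (1 + y) + 2 * (2 + (x + x)) + 1 ≡ 1 + (r + r)
    labelled = solve-∀

  uv-second : ∀ w → Hit scheme (suc (suc w + suc w)) (oddLabel (suc (suc w) + w))
  uv-second w = hit uv 1ℙ 0 (suc w + suc w) refl (labelled w)
    where
    labelled : ∀ w → let r = 2 + w + w in 2 * ((1 + w) + (1 + w)) + 1 ≡ 1 + (r + r)
    labelled = solve-∀

  u₁ : ∀ w → Segment scheme (suc (suc w + suc w)) oddLabel (suc (suc w) + w + 1) w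
  u₁ w .hitAt x x<w with (y , refl) ← m≤n⇒∃[o]m+o≡n x<w =
    hit u 1ℙ (suc y) (suc (suc (x + x))) (fits x y) (labelled x y)
    where
    fits : ∀ x y → let w = 1 + (x + y) ; k = 1 + ((1 + w) + (1 + w)) in
          1 + (1 + ((1 + y) + (1 + y)) + (2 + (x + x))) ≡ 1 + k
    fits = solve-∀
    labelled : ∀ x y → let w = 1 + (x + y) ; r = 2 + w + w + 1 + x in
          4 * (1 + y) + 3 * (2 + (x + x)) + 1 ≡ 1 + (r + r)
    labelled = solve-∀

  v-first : ∀ w → Hit scheme (suc (suc w + suc w)) (oddLabel (suc (suc w) + w + 1 + w))
  v-first w = hit v 0ℙ 0 (suc (suc w + suc w)) refl (labelled w)
    where
    labelled : ∀ w → let r = 2 + w + w + 1 + w in 3 * ((1 + w) + (1 + w)) + 1 ≡ 1 + (r + r)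
    labelled = solve-∀

  uv-penultimate : ∀ w → Hit scheme (suc (suc w + suc w)) (oddLabel (suc (suc w) + w + 1 + w + 1))
  uv-penultimate w = hit uv 0ℙ (suc w) 1 (fits-penultimate w) (labelled w)
    where
    labelled : ∀ w → let r = 2 + w + w + 1 + w + 1 in 6 * (1 + w) + 3 ≡ 1 + (r + r)
    labelled = solve-∀

  u-penultimate : ∀ w → Hit scheme (suc (suc w + suc w)) (oddLabel (suc (suc w) + w + 1 + w + 1 + 1))
  u-penultimate w = hit u 0ℙ (suc w) 1 (fits-penultimate w) (labelled w)
    where
    labelled : ∀ w → let r = 2 + w + w + 1 + w + 1 + 1 in 6 * (1 + w) + 5 ≡ 1 + (r + r)
    labelled = solve-∀

  uv₁ : ∀ w → Segment scheme (suc (suc w + suc w)) oddLabel (suc (suc w) + w + 1 + w + 1 + 1 + 1) w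
  uv₁ w .hitAt x x<w with (y , refl) ← m≤n⇒∃[o]m+o≡n x<w =
    hit uv 1ℙ (suc x) (suc y + suc y) (fits x y) (labelled x y)
    where
    fits : ∀ x y → let w = 1 + (x + y) ; k = 1 + ((1 + w) + (1 + w)) in
          1 + (1 + ((1 + x) + (1 + x)) + ((1 + y) + (1 + y))) ≡ 1 + k
    fits = solve-∀
    labelled : ∀ x y → let w = 1 + (x + y) ; r = 2 + w + w + 1 + w + 1 + 1 + 1 + x in
               8 * (1 + x) + 3 * ((1 + y) + (1 + y)) + 5 ≡ 1 + (r + r)
    labelled = solve-∀

  u-second : ∀ w → Hit scheme (suc (suc w + suc w)) (oddLabel (suc (suc w) + w + 1 + w + 1 + 1 + 1 + w))
  u-second w = hit u 1ℙ 0 (suc w + suc w) refl (labelled w)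
    where
    labelled : ∀ w → let r = 2 + w + w + 1 + w + 1 + 1 + 1 + w in 4 * ((1 + w) + (1 + w)) + 5 ≡ 1 + (r + r)
    labelled = solve-∀

  v-last : ∀ w → Hit scheme (suc (suc w + suc w)) (oddLabel (suc (suc w) + w + 1 + w + 1 + 1 + 1 + w + 1))
  v-last w = hit v 1ℙ (suc w) 0 (fits-last w) (labelled w)
    where
    labelled : ∀ w → let r = 2 + w + w + 1 + w + 1 + 1 + 1 + w + 1 in 8 * (1 + w) + 7 ≡ 1 + (r + r)
    labelled = solve-∀

  vv₁ : ∀ w → Segment scheme (suc (suc w + suc w)) evenLabel 0 (suc w)
  vv₁ w .hitAt x x≤w with (y , refl) ← m≤n⇒∃[o]m+o≡n x≤w =
    hit vv 1ℙ x (suc (y + y)) (fits x y) (labelled x)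
    where
    fits : ∀ x y → let w = x + y in 1 + (1 + (x + x) + (1 + (y + y))) ≡ 1 + ((1 + w) + (1 + w))
    fits = solve-∀
    labelled : ∀ x → 2 * x + 2 ≡ 2 + (x + x)
    labelled = solve-∀

  v₁ : ∀ w → Segment scheme (suc (suc w + suc w)) evenLabel (suc w) w
  v₁ w .hitAt x x<w with (y , refl) ← m≤n⇒∃[o]m+o≡n x<w =
    hit v 1ℙ (suc y) (suc x + suc x) (fits x y) (labelled x y)
    where
    fits : ∀ x y → let w = 1 + (x + y) ; k = 1 + ((1 + w) + (1 + w)) in
          1 + (1 + ((1 + y) + (1 + y)) + ((1 + x) + (1 + x))) ≡ 1 + k
    fits = solve-∀
    labelled : ∀ x y → let w = 1 + (x + y) ; r = 1 + w + x in
          2 * (1 + y) + 2 * ((1 + x) + (1 + x)) ≡ 2 + (r + r)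
    labelled = solve-∀

  uv-last : ∀ w → Hit scheme (suc (suc w + suc w)) (evenLabel (suc w + w))
  uv-last w = hit uv 1ℙ (suc w) 0 (fits-last w) (labelled w)
    where
    labelled : ∀ w → let r = 1 + w + w in 4 * (1 + w) ≡ 2 + (r + r)
    labelled = solve-∀

  v-penultimate : ∀ w → Hit scheme (suc (suc w + suc w)) (evenLabel (suc w + w + 1))
  v-penultimate w = hit v 0ℙ (suc w) 1 (fits-penultimate w) (labelled w)
    where
    labelled : ∀ w → let r = 1 + w + w + 1 in 4 * (1 + w) + 2 ≡ 2 + (r + r)
    labelled = solve-∀

  uv-first : ∀ w → Hit scheme (suc (suc w + suc w)) (evenLabel (suc w + w + 1 + 1))
  uv-first w = hit uv 0ℙ 0 (suc (suc w + suc w)) refl (labelled w)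
    where
    labelled : ∀ w → let k = 1 + ((1 + w) + (1 + w)) ; r = 1 + w + w + 1 + 1 in 2 * k + 2 ≡ 2 + (r + r)
    labelled = solve-∀

  u₀ : ∀ w → Segment scheme (suc (suc w + suc w)) evenLabel (suc w + w + 1 + 1 + 1) w
  u₀ w .hitAt x x<w with (y , refl) ← m≤n⇒∃[o]m+o≡n x<w =
    hit u 0ℙ (suc y) (suc (suc (suc (x + x)))) (fits x y) (labelled x y)
    where
    fits : ∀ x y → let w = 1 + (x + y) ; k = 1 + ((1 + w) + (1 + w)) in
          1 + ((1 + y) + (1 + y) + (3 + (x + x))) ≡ 1 + k
    fits = solve-∀
    labelled : ∀ x y → let w = 1 + (x + y) ; r = 1 + w + w + 1 + 1 + 1 + x in
          4 * (1 + y) + 3 * (3 + (x + x)) + 1 ≡ 2 + (r + r)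
    labelled = solve-∀

  v-second : ∀ w → Hit scheme (suc (suc w + suc w)) (evenLabel (suc w + w + 1 + 1 + 1 + w))
  v-second w = hit v 1ℙ 0 (suc w + suc w) refl (labelled w)
    where
    labelled : ∀ w → let r = 1 + w + w + 1 + 1 + 1 + w in 3 * ((1 + w) + (1 + w)) + 4 ≡ 2 + (r + r)
    labelled = solve-∀

  uv₀ : ∀ w → Segment scheme (suc (suc w + suc w)) evenLabel (suc w + w + 1 + 1 + 1 + w + 1) w
  uv₀ w .hitAt x x<w with (y , refl) ← m≤n⇒∃[o]m+o≡n x<w =
    hit uv 0ℙ (suc x) (suc (suc (suc (y + y)))) (fits x y) (labelled x y)
    where
    fits : ∀ x y → let w = 1 + (x + y) ; k = 1 + ((1 + w) + (1 + w)) in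
          1 + ((1 + x) + (1 + x) + (3 + (y + y))) ≡ 1 + k
    fits = solve-∀
    labelled : ∀ x y → let w = 1 + (x + y) ; r = 1 + w + w + 1 + 1 + 1 + w + 1 + x in
               8 * (1 + x) + 3 * (3 + (y + y)) + 1 ≡ 2 + (r + r)
    labelled = solve-∀

  u-first : ∀ w → Hit scheme (suc (suc w + suc w)) (evenLabel (suc w + w + 1 + 1 + 1 + w + 1 + w))
  u-first w = hit u 0ℙ 0 (suc (suc w + suc w)) refl (labelled w)
    where
    labelled : ∀ w → let k = 1 + ((1 + w) + (1 + w)) ; r = 1 + w + w + 1 + 1 + 1 + w + 1 + w in
          4 * k ≡ 2 + (r + r)
    labelled = solve-∀

  u-last : ∀ w → Hit scheme (suc (suc w + suc w)) (evenLabel (suc w + w + 1 + 1 + 1 + w + 1 + w + 1))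
  u-last w = hit u 1ℙ (suc w) 0 (fits-last w) (labelled w)
    where
    labelled : ∀ w → let r = 1 + w + w + 1 + 1 + 1 + w + 1 + w + 1 in 8 * (1 + w) + 6 ≡ 2 + (r + r)
    labelled = solve-∀

  covers : ∀ w → Covers scheme (suc (suc w + suc w))
  covers w =
      resize (vv₀ (suc w) ▹ v₀ w ▹ point (uv-second w) ▹ u₁ w ▹ point (v-first w) ▹ point (uv-penultimate w)
              ▹ point (u-penultimate w) ▹ uv₁ w ▹ point (u-second w) ▹ point (v-last w))
             (odd-total w)
    , resize (vv₁ w ▹ v₁ w ▹ point (uv-last w) ▹ point (v-penultimate w) ▹ point (uv-first w) ▹ u₀ w
              ▹ point (v-second w) ▹ uv₀ w ▹ point (u-first w) ▹ point (u-last w))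
             (even-total w)
    where
    odd-total : ∀ w → let k = 1 + ((1 + w) + (1 + w)) in
                (2 + w) + (w + (1 + (w + (1 + (1 + (1 + (w + (1 + 1)))))))) ≡ (1 + k) + (1 + k)
    odd-total = solve-∀
    even-total : ∀ w → let k = 1 + ((1 + w) + (1 + w)) in
                 (1 + w) + (w + (1 + (1 + (1 + (w + (1 + (w + (1 + 1)))))))) ≡ k + (1 + k)
    even-total = solve-∀

mainTheorem3 : (n : ℕ) → n ≥ 3 → IsChiLat (firecracker1 n) 2
mainTheorem3 zero ()
mainTheorem3 (suc k) n≥3 with coordinates k | position-coordinates k
... | 0ℙ , w     | refl = Firecracker.chiLat≡2 (w + w) OddOrder.scheme
                             (OddOrder.α≢β (w + w)) (OddOrder.balanced w) (OddOrder.covers w)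
... | 1ℙ , zero  | refl = contradiction n≥3 λ { (s≤s (s≤s ())) }
... | 1ℙ , suc w | refl = Firecracker.chiLat≡2 (suc (suc w + suc w)) EvenOrder.scheme
                             (EvenOrder.α≢β (suc (suc w + suc w))) (EvenOrder.balanced w) (EvenOrder.covers w)
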